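{- For every strongly connected digraph $G$, $\tau(G,\text{reach})\le2$.
   Context: For a digraph $G=(V,E)$, a labeling is a map $\lambda:E\to 2^{\mathbb{N}}$. $\lambda$ preserves a path $(e_1,\dots,e_k)$ if there are labels $l_1<\dots<l_k$ with $l_i\in\lambda(e_i)$. reach$(G)$ is the set of labelings $\lambda$ such that for all $u,v\in V$ with $v$ reachable from $u$ in $G$, $\lambda$ preserves at least one simple path from $u$ to $v$. $\tau(G,\text{reach})=\min_{\lambda\in\text{reach}(G)}\max_{e\in E}|\lambda(e)|$. -}

module Defs where

open import Data.Nat using (ℕ; suc; _≤_; _<_)
open import Data.Fin using (Fin)
open import Data.Bool using (Bool; T)
open import Data.List using (List; []; _∷_; length)
open import Data.List.Membership.Propositional using (_∈_)
open import Data.List.Relation.Unary.Unique.Propositional using (Unique)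
open import Data.Product using (Σ; ∃; _×_; _,_)
open import Data.Unit using (⊤)

record Digraph : Set where
  field
    n   : ℕ
    adj : Fin n → Fin n → Bool

module _ (G : Digraph) where
  open Digraph G

  Edge : Fin n → Fin n → Set
  Edge u v = T (adj u v)

  data Path : Fin n → Fin n → Set where
    []  : ∀ {u} → Path u u
    _∷_ : ∀ {u w v} → Edge u w → Path w v → Path u v

  vertices : ∀ {u v} → Path u v → List (Fin n)
  vertices {u} []       = u ∷ []
  vertices {u} (_ ∷ p)  = u ∷ vertices p

  Simple : ∀ {u v} → Path u v → Set
  Simple p = Unique (vertices p)

  Reachable : Fin n → Fin n → Set
  Reachable u v = Path u v

  StronglyConnected : Set
  StronglyConnected = ∀ u v → Reachable u v

  -- A labeling assigns a finite set of labels (as a list) to each edge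
  -- (values on non-edges are irrelevant).
  Labeling : Set
  Labeling = Fin n → Fin n → List ℕ

  PreservesFrom : Labeling → ℕ → ∀ {u v} → Path u v → Set
  PreservesFrom λ' b []                 = ⊤
  PreservesFrom λ' b (_∷_ {u} {w} e p)  = ∃ λ l → (l ∈ λ' u w) × (b ≤ l) × PreservesFrom λ' (suc l) p

  Preserves : Labeling → ∀ {u v} → Path u v → Set
  Preserves λ' p = PreservesFrom λ' 0 p

  InReach : Labeling → Set
  InReach λ' = ∀ u v → Reachable u v →
    Σ (Path u v) (λ p → Simple p × Preserves λ' p)

  MaxLabels≤ : Labeling → ℕ → Set
  MaxLabels≤ λ' k = ∀ u v → Edge u v → length (λ' u v) ≤ k

  τReach≤ : ℕ → Set
  τReach≤ k = Σ Labeling (λ λ' → InReach λ' × MaxLabels≤ λ' k)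

-- Fix a root r.  Since G is strongly connected it has a spanning
-- in-tree (every u ≠ r has an edge to  next u,  strictly closer to r)
-- and a spanning out-tree (every v ≠ r has an edge from  parent v,
-- strictly closer to r in the reversed graph); both come from shortest
-- distances to r (InTree, inTree).  With B bounding the in-tree heights,
-- the in-tree edge  x → next x  gets label  B ∸ height x  and the
-- out-tree edge  parent v → v  gets label  B + depth v.  To go from x to
-- v, climb the in-tree (labels increase as the height drops) up to the
-- first vertex that is an out-tree ancestor of v, then descend the
-- out-tree to v (labels exceed B and increase with depth).  The route is
-- simple: climbed vertices have decreasing heights and are not ancestors
-- of v, descended vertices have increasing depths and are ancestors of v.
module Submission where

open import Defs
open import Data.Nat using (ℕ; zero; suc; _+_; _∸_; _≤_; _<_; z≤n; s≤s)
open import Data.Nat.Properties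
  using (≤-refl; ≤-trans; <⇒≤; <-irrefl; ≮⇒≥; ≤-<-trans; <-≤-trans; m∸n≤m; m≤m+n; n≤1+n; +-monoʳ-<; ∸-monoʳ-<; +-mono-≤; anyUpTo?)
open import Data.Nat.Induction using (<-wellFounded)
open import Data.Fin using (Fin; zero; _≟_)
open import Data.Fin.Properties using (any?)
open import Data.List using (List; []; _∷_; length; _++_; map; allFin)
open import Data.List.Properties using (length-++)
open import Data.List.Extrema.Nat using (max; xs≤max)
open import Data.List.Membership.Propositional using (_∈_; _∉_)
open import Data.List.Membership.Propositional.Properties using (∈-allFin; ∈-map⁺; ∈-++⁺ˡ; ∈-++⁺ʳ)
open import Data.List.Relation.Unary.Any using (here; there)
open import Data.List.Relation.Unary.All as All using ([]; _∷_)
open import Data.List.Relation.Unary.AllPairs using ([]; _∷_)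
open import Data.Product using (Σ; ∃; _×_; _,_; proj₁; proj₂)
open import Data.Sum using (_⊎_; inj₁; inj₂; [_,_]′; map₁)
open import Data.Empty using (⊥-elim)
open import Data.Unit using (tt)
open import Function using (_on_)
open import Induction.WellFounded using (Acc; acc)
open import Relation.Binary.Construct.On using (wellFounded)
open import Relation.Nullary using (Dec; yes; no)
open import Relation.Nullary.Decidable using (¬?; _×-dec_; T?)
open import Relation.Unary using (Decidable)
open import Relation.Binary.PropositionalEquality using (_≡_; _≢_; refl; sym; subst)

least : ∀ {P : ℕ → Set} → Decidable P → ∀ {k} → P k →
        ∃ λ m → P m × (∀ {j} → P j → m ≤ j)
least {P} P? = go (<-wellFounded _)
  where
    go : ∀ {k} → Acc _<_ k → P k → ∃ λ m → P m × (∀ {j} → P j → m ≤ j)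
    go {k} (acc smaller) pk with anyUpTo? P? k
    ... | yes (j , j<k , pj) = go (smaller j<k) pj
    ... | no noneBelow = k , pk , λ {j} pj → ≮⇒≥ (λ j<k → noneBelow (j , j<k , pj))

preservesFrom-mono : ∀ (G : Digraph) (λ' : Labeling G) {u v} (p : Path G u v) {b b'} →
                     b' ≤ b → PreservesFrom G λ' b p → PreservesFrom G λ' b' p
preservesFrom-mono G λ' []      _    _                       = tt
preservesFrom-mono G λ' (_ ∷ p) b'≤b (l , l∈ , b≤l , rest) = l , l∈ , ≤-trans b'≤b b≤l , rest

simple-∷ : ∀ (G : Digraph) {u w v} (e : Edge G u w) (p : Path G w v) →
           u ∉ vertices G p → Simple G p → Simple G (e ∷ p)
simple-∷ G e p u∉p simple = All.tabulate (λ y∈p u≡y → u∉p (subst (_∈ vertices G p) (sym u≡y) y∈p)) ∷ simple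

reverse : Digraph → Digraph
reverse G = record { n = Digraph.n G ; adj = λ u v → Digraph.adj G v u }

reverse-path : ∀ (G : Digraph) {u v} → Path G u v → Path (reverse G) v u
reverse-path G p = go p []
  where
    go : ∀ {u w t} → Path G u w → Path (reverse G) u t → Path (reverse G) w t
    go []      back = back
    go (e ∷ p) back = go p (e ∷ back)

module _ (H : Digraph) where
  open Digraph H

  record InTree (r : Fin n) : Set where
    field
      next      : Fin n → Fin n
      rank      : Fin n → ℕ
      next-edge : ∀ {u} → u ≢ r → Edge H u (next u)
      next-rank : ∀ {u} → u ≢ r → rank (next u) < rank u

    induction : (P : Fin n → Set) → (∀ u → (u ≢ r → P (next u)) → P u) → ∀ u → P u
    induction P step u = go (wellFounded rank <-wellFounded u)
      where
        go : ∀ {u} → Acc (_<_ on rank) u → P u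
        go {u} (acc closer) = step u (λ u≢r → go (closer (next-rank u≢r)))

  module _ (r : Fin n) where

    data Within : ℕ → Fin n → Set where
      at-root : ∀ {k} → Within k r
      hop     : ∀ {k u w} → Edge H u w → Within k w → Within (suc k) u

    within? : ∀ k u → Dec (Within k u)
    within? k u with u ≟ r
    ... | yes refl = yes at-root
    within? zero    u | no u≢r = no λ { at-root → u≢r refl }
    within? (suc k) u | no u≢r with any? (λ w → T? (adj u w) ×-dec within? k w)
    ... | yes (_ , e , h) = yes (hop e h)
    ... | no noStep       = no λ { at-root → u≢r refl ; (hop e h) → noStep (_ , e , h) }

    path-within : ∀ {u} → Path H u r → ∃ λ k → Within k u
    path-within []      = 0 , at-root
    path-within (e ∷ p) with path-within p
    ... | k , h = suc k , hop e h

    -- If every vertex reaches r, the shortest-walk distance to r defines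
    -- an in-tree: a shortest walk from u ≠ r starts with an edge to a
    -- vertex of smaller distance.
    inTree : (∀ u → Path H u r) → InTree r
    inTree reach = record
      { next      = λ u → proj₁ (closer u)
      ; rank      = dist
      ; next-edge = λ u≢r → proj₁ (proj₂ (closer _) u≢r)
      ; next-rank = λ u≢r → proj₂ (proj₂ (closer _) u≢r)
      }
      where
        shortest : ∀ u → ∃ λ m → Within m u × (∀ {j} → Within j u → m ≤ j)
        shortest u = least (λ k → within? k u) (proj₂ (path-within (reach u)))

        dist : Fin n → ℕ
        dist u = proj₁ (shortest u)

        first-step : ∀ {m u} → Within m u → u ≢ r → ∃ λ w → Edge H u w × dist w < m
        first-step at-root   r≢r = ⊥-elim (r≢r refl)
        first-step (hop e h) _   = _ , e , s≤s (proj₂ (proj₂ (shortest _)) h)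

        -- The root gets an arbitrary successor; the case split is done on
        -- a separate argument so that it does not rewrite  dist u.
        closer : ∀ u → Σ (Fin n) λ w → u ≢ r → Edge H u w × dist w < dist u
        closer u = choose (u ≟ r)
          where
            choose : Dec (u ≡ r) → Σ (Fin n) λ w → u ≢ r → Edge H u w × dist w < dist u
            choose (yes u≡r) = r , λ u≢r → ⊥-elim (u≢r u≡r)
            choose (no u≢r) with first-step (proj₁ (proj₂ (shortest u))) u≢r
            ... | w , e , lt = w , λ _ → e , lt

onlyIf : ∀ {P : Set} → Dec P → ℕ → List ℕ
onlyIf (yes _) l = l ∷ []
onlyIf (no _)  l = []

onlyIf-∈ : ∀ {P : Set} (d : Dec P) {l} → P → l ∈ onlyIf d l
onlyIf-∈ (yes _) _ = here refl
onlyIf-∈ (no ¬p) p = ⊥-elim (¬p p)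

onlyIf-length : ∀ {P : Set} (d : Dec P) l → length (onlyIf d l) ≤ 1
onlyIf-length (yes _) _ = s≤s z≤n
onlyIf-length (no _)  _ = z≤n

module TwoLabels (G : Digraph) (r : Fin (Digraph.n G))
                 (inT : InTree G r) (outT : InTree (reverse G) r) where
  open Digraph G
  open InTree inT using (next; next-edge; next-rank) renaming (rank to height)
  open InTree outT using () renaming
    (next to parent; next-edge to parent-edge; next-rank to parent-depth; rank to depth; induction to out-induction)

  -- B bounds all heights, so in-tree labels are ≤ B < out-tree labels.
  B : ℕ
  B = max 0 (map height (allFin n))

  height≤B : ∀ x → height x ≤ B
  height≤B x = All.lookup (xs≤max 0 (map height (allFin n))) (∈-map⁺ height (∈-allFin x))

  inLabel outLabel : Fin n → Fin n → List ℕ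
  inLabel  x y = onlyIf (¬? (x ≟ r) ×-dec (next x ≟ y)) (B ∸ height x)
  outLabel x y = onlyIf (¬? (y ≟ r) ×-dec (parent y ≟ x)) (B + depth y)

  label : Labeling G
  label x y = inLabel x y ++ outLabel x y

  label-in : ∀ {x} → x ≢ r → B ∸ height x ∈ label x (next x)
  label-in {x} x≢r = ∈-++⁺ˡ (onlyIf-∈ (¬? (x ≟ r) ×-dec (next x ≟ next x)) (x≢r , refl))

  label-out : ∀ {w} → w ≢ r → B + depth w ∈ label (parent w) w
  label-out {w} w≢r = ∈-++⁺ʳ (inLabel (parent w) w) (onlyIf-∈ (¬? (w ≟ r) ×-dec (parent w ≟ parent w)) (w≢r , refl))

  label-size : MaxLabels≤ G label 2
  label-size x y _ = subst (_≤ 2) (sym (length-++ (inLabel x y)))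
                           (+-mono-≤ (onlyIf-length (¬? (x ≟ r) ×-dec (next x ≟ y)) _)
                                     (onlyIf-length (¬? (y ≟ r) ×-dec (parent y ≟ x)) _))

  data _≼_ : Fin n → Fin n → Set where
    stop : ∀ {v} → v ≼ v
    down : ∀ {a w v} → w ≢ r → parent w ≡ a → w ≼ v → a ≼ v

  ≼-parent : ∀ {a v} → a ≼ parent v → v ≢ r → a ≼ v
  ≼-parent stop           v≢r = down v≢r refl stop
  ≼-parent (down w≢r eq c) v≢r = down w≢r eq (≼-parent c v≢r)

  ≼-last : ∀ {a v} → a ≼ v → a ≡ v ⊎ (v ≢ r × a ≼ parent v)
  ≼-last stop = inj₁ refl
  ≼-last (down w≢r refl c) with ≼-last c
  ... | inj₁ refl        = inj₂ (w≢r , stop)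
  ... | inj₂ (v≢r , c′) = inj₂ (v≢r , down w≢r refl c′)

  root-≼ : ∀ v → r ≼ v
  root-≼ = out-induction (r ≼_) step
    where
      step : ∀ v → (v ≢ r → r ≼ parent v) → r ≼ v
      step v ih with v ≟ r
      ... | yes refl = stop
      ... | no v≢r   = ≼-parent (ih v≢r) v≢r

  _≼?_ : ∀ a v → Dec (a ≼ v)
  a ≼? v = out-induction (λ v → Dec (a ≼ v)) step v
    where
      step : ∀ v → (v ≢ r → Dec (a ≼ parent v)) → Dec (a ≼ v)
      step v ih with a ≟ v
      ... | yes refl = yes stop
      ... | no a≢v with v ≟ r
      ...   | yes refl = no λ c → [ a≢v , (λ (r≢r , _) → r≢r refl) ]′ (≼-last c)
      ...   | no v≢r with ih v≢r
      ...     | yes c = yes (≼-parent c v≢r)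
      ...     | no ¬c = no λ c → [ a≢v , (λ (_ , c′) → ¬c c′) ]′ (≼-last c)

  descend : ∀ {a v} → a ≼ v →
            Σ (Path G a v) λ p → Simple G p × PreservesFrom G label (suc (B + depth a)) p
                               × (∀ {y} → y ∈ vertices G p → depth a ≤ depth y × y ≼ v)
  descend stop = [] , [] ∷ [] , tt , λ { (here refl) → ≤-refl , stop }
  descend (down {w = w} w≢r refl c) with descend c
  ... | p , simple , pres , below =
      parent-edge w≢r ∷ p
    , simple-∷ G (parent-edge w≢r) p fresh simple
    , (B + depth w , label-out w≢r , +-monoʳ-< B (parent-depth w≢r) , pres)
    , λ { (here refl) → ≤-refl , down w≢r refl c
        ; (there y∈p) → ≤-trans (<⇒≤ (parent-depth w≢r)) (proj₁ (below y∈p)) , proj₂ (below y∈p) }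
    where
      fresh : parent w ∉ vertices G p
      fresh pw∈p = <-irrefl refl (<-≤-trans (parent-depth w≢r) (proj₁ (below pw∈p)))

  Route : Fin n → Fin n → Set
  Route x v = Σ (Path G x v) λ p → Simple G p × PreservesFrom G label (B ∸ height x) p
                               × (∀ {y} → y ∈ vertices G p → height y ≤ height x ⊎ y ≼ v)

  -- Induction on the height of x: stop climbing at an ancestor of v;
  -- otherwise x ≠ r (r is an ancestor of v) and we climb to next x.
  route : ∀ x v → Route x v
  route x v = InTree.induction inT (λ x → Route x v) step x
    where
      step : ∀ x → (x ≢ r → Route (next x) v) → Route x v
      step x ih with x ≼? v
      ... | yes x≼v with descend x≼v
      ...   | p , simple , pres , below =
          p , simple
        , preservesFrom-mono G label p (≤-trans (m∸n≤m B (height x)) (≤-trans (m≤m+n B (depth x)) (n≤1+n _))) pres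
        , λ y∈p → inj₂ (proj₂ (below y∈p))
      step x ih | no x⋠v with x ≟ r
      ... | yes refl = ⊥-elim (x⋠v (root-≼ v))
      ... | no x≢r with ih x≢r
      ...   | p , simple , pres , visited =
          next-edge x≢r ∷ p
        , simple-∷ G (next-edge x≢r) p fresh simple
        , (B ∸ height x , label-in x≢r , ≤-refl
          , preservesFrom-mono G label p (∸-monoʳ-< (next-rank x≢r) (height≤B x)) pres)
        , λ { (here refl) → inj₁ ≤-refl
            ; (there y∈p) → map₁ (λ le → ≤-trans le (<⇒≤ (next-rank x≢r))) (visited y∈p) }
        where
          fresh : x ∉ vertices G p
          fresh x∈p with visited x∈p
          ... | inj₁ le = <-irrefl refl (≤-<-trans le (next-rank x≢r))
          ... | inj₂ x≼v = x⋠v x≼v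

  τ≤2 : τReach≤ G 2
  τ≤2 = label , reaches , label-size
    where
      reaches : InReach G label
      reaches u v _ with route u v
      ... | p , simple , pres , _ = p , simple , preservesFrom-mono G label p z≤n pres

-- The empty digraph needs no labels; otherwise root the trees at vertex 0,
-- the out-tree being an in-tree of the reversed graph.
lemma4 : (G : Digraph) → StronglyConnected G → τReach≤ G 2
lemma4 record { n = zero } sc = (λ _ _ → []) , (λ ()) , (λ ())
lemma4 G@(record { n = suc _ }) sc =
  TwoLabels.τ≤2 G zero (inTree G zero (λ u → sc u zero))
                       (inTree (reverse G) zero (λ v → reverse-path G (sc zero v)))
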